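{- Let $(\mathbb{H},+,0)$ be an Abelian group and $\rho$ a translation invariant metric on $\mathbb{H}$. Let $\mathcal{W}$ be a finite $8$-good qif of subsets of $\mathbb{H}$. Assume that (a) $\mathcal{V}$ is a family of nonempty subsets of $\mathbb{H}$ and $\mathcal{W}$ is immersed in $\mathcal{V}$; (b) $A'\subseteq A\subseteq\mathbb{H}$ and $|A'|=8$; (c) $A-A\subseteq\bigcup\{W-W': W,W'\in\mathcal{W}\}$; (d) if $a,b\in A$ and $a\ne b$, then $\rho(a,b)>\operatorname{diam}_\rho(W)$ for all $W\in\mathcal{W}$. Then: (1) if $c\in\mathbb{H}$ is such that $A'+c\subseteq\bigcup\mathcal{W}$, then $A+c\subseteq\bigcup\mathcal{V}$; (2) if $c\in\mathbb{H}$ is such that $c-A'\subseteq\bigcup\mathcal{W}$, then $c-A\subseteq\bigcup\mathcal{V}$.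
   Context: A metric $\rho$ on $\mathbb{H}$ is translation invariant if $\rho(a+c,b+c)=\rho(a,b)$ for all $a,b,c$. For $X,Y\subseteq\mathbb{H}$, $X+Y=\{x+y\}$, $X-Y=\{x-y\}$, $c-X=\{c-x:x\in X\}$. A family $\mathcal{V}$ of nonempty subsets of $\mathbb{H}$ is an $n$-good qif if $|\mathcal{V}|\ge n$, its members are pairwise disjoint, and for all distinct $V_0,\dots,V_{n-1}\in\mathcal{V}$, all $b_i,b_i'\in V_i$ ($i<n$) and all $\iota_i,\iota_i'\in\{ -1,0,1\}$ with $\sum_{i<n}(\iota_i+\iota_i')^2\neq0$ we have $\sum_{i<n}(\iota_ib_i+\iota_i'b_i')\ne 0$. For families $\mathcal{W},\mathcal{V}$ of nonempty subsets of $\mathbb{H}$, $\mathcal{W}$ is immersed in $\mathcal{V}$ if there is a bijection $\pi:\mathcal{W}\to\mathcal{V}$ such that $W\subseteq\pi(W)$ for all $W\in\mathcal{W}$, and whenever $W_0,W_1\in\mathcal{W}$, $a,a'\in W_0$, $b\in W_1$, then $(a-a')+b\in\pi(W_1)$. -}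

module Defs where

open import Level using (Level; _⊔_) renaming (suc to lsuc)
open import Data.Nat using (ℕ; zero; suc)
open import Data.Fin using (Fin; zero; suc)
open import Data.Integer as ℤ using (ℤ)
open import Data.Product using (Σ; ∃; _×_; _,_)
open import Relation.Nullary using (¬_)
open import Relation.Binary.PropositionalEquality using (_≡_; _≢_)
open import Relation.Binary.Structures using (IsTotalOrder)
open import Algebra.Structures using (IsAbelianGroup)
open import Relation.Unary using (Pred)

record AbGroup (c : Level) : Set (lsuc c) where
  infixl 6 _+_ _-_
  infix 8 -_
  field
    Carrier        : Set c
    _+_            : Carrier → Carrier → Carrier
    0#             : Carrier
    -_             : Carrier → Carrier
    isAbelianGroup : IsAbelianGroup _≡_ _+_ 0# -_
  _-_ : Carrier → Carrier → Carrier
  x - y = x + (- y)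

record OrderedAbGroup (c ℓ : Level) : Set (lsuc (c ⊔ ℓ)) where
  infixl 6 _+_
  infix 4 _≤_ _<_
  field
    Carrier        : Set c
    _+_            : Carrier → Carrier → Carrier
    0#             : Carrier
    -_             : Carrier → Carrier
    _≤_            : Carrier → Carrier → Set ℓ
    isAbelianGroup : IsAbelianGroup _≡_ _+_ 0# -_
    isTotalOrder   : IsTotalOrder _≡_ _≤_
    +-monoˡ-≤      : ∀ {x y} z → x ≤ y → x + z ≤ y + z
  _<_ : Carrier → Carrier → Set (c ⊔ ℓ)
  x < y = x ≤ y × x ≢ y

module _ {c r ℓ : Level} (G : AbGroup c) (R : OrderedAbGroup r ℓ) where
  private
    module G = AbGroup G
    module R = OrderedAbGroup R
  open G using (Carrier; _+_)

  record IsMetric (ρ : Carrier → Carrier → R.Carrier) : Set (c ⊔ r ⊔ ℓ) where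
    field
      nonneg   : ∀ x y → R.0# R.≤ ρ x y
      zero⇒eq  : ∀ x y → ρ x y ≡ R.0# → x ≡ y
      eq⇒zero  : ∀ x → ρ x x ≡ R.0#
      sym      : ∀ x y → ρ x y ≡ ρ y x
      triangle : ∀ x y z → ρ x z R.≤ ρ x y R.+ ρ y z

  TranslationInvariant : (Carrier → Carrier → R.Carrier) → Set (c ⊔ r)
  TranslationInvariant ρ = ∀ a b c′ → ρ (a + c′) (b + c′) ≡ ρ a b

  -- diam_ρ(W) < r, i.e. sup{ρ(x,y) : x,y ∈ W} < r, written without suprema:
  -- some bound t < r bounds all distances within W.
  DiamLT : ∀ {p} → (Carrier → Carrier → R.Carrier) → Pred Carrier p → R.Carrier → Set (c ⊔ r ⊔ ℓ ⊔ p)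
  DiamLT ρ W s = Σ R.Carrier λ t → (t R.< s) × (∀ x y → W x → W y → ρ x y R.≤ t)

data Sgn : Set where
  neg zer pos : Sgn

toℤ : Sgn → ℤ
toℤ neg = ℤ.- (ℤ.+ 1)
toℤ zer = ℤ.+ 0
toℤ pos = ℤ.+ 1

sumℤ : ∀ {n} → (Fin n → ℤ) → ℤ
sumℤ {zero}  f = ℤ.+ 0
sumℤ {suc n} f = f zero ℤ.+ sumℤ (λ i → f (suc i))

module _ {c : Level} (G : AbGroup c) where
  open AbGroup G

  _·_ : Sgn → Carrier → Carrier
  neg · b = - b
  zer · b = 0#
  pos · b = b

  sumH : ∀ {n} → (Fin n → Carrier) → Carrier
  sumH {zero}  f = 0#
  sumH {suc n} f = f zero + sumH (λ i → f (suc i))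

  Nonempty : ∀ {p} → Pred Carrier p → Set (c ⊔ p)
  Nonempty X = ∃ λ x → X x

  Disjoint : ∀ {p} → Pred Carrier p → Pred Carrier p → Set (c ⊔ p)
  Disjoint X Y = ∀ x → X x → Y x → Data.Empty.⊥
    where import Data.Empty

  -- A finite family 𝒲 = {W i : i < m} (indexed injectively, which follows
  -- from disjointness and nonemptiness) is an n-good qif.
  record IsGoodQif {p} (n m : ℕ) (W : Fin m → Pred Carrier p) : Set (c ⊔ p) where
    field
      size     : n Data.Nat.≤ m
      nonempty : ∀ i → Nonempty (W i)
      disjoint : ∀ i j → i ≢ j → Disjoint (W i) (W j)
      qif      : (f : Fin n → Fin m) → (∀ i j → f i ≡ f j → i ≡ j) →
                 (b b′ : Fin n → Carrier) →
                 (∀ i → W (f i) (b i)) → (∀ i → W (f i) (b′ i)) →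
                 (ι ι′ : Fin n → Sgn) →
                 sumℤ (λ i → (toℤ (ι i) ℤ.+ toℤ (ι′ i)) ℤ.* (toℤ (ι i) ℤ.+ toℤ (ι′ i))) ≢ ℤ.+ 0 →
                 sumH (λ i → (ι i · b i) + (ι′ i · b′ i)) ≢ 0#

  -- 𝒲 = {W i} is immersed in 𝒱 = {V i} via the bijection π(W i) = V i.
  -- (𝒱 is given through this bijection; its members V i are pairwise distinct.)
  record IsImmersed {p} {m : ℕ} (W V : Fin m → Pred Carrier p) : Set (c ⊔ p) where
    field
      V-nonempty : ∀ i → Nonempty (V i)
      V-distinct : ∀ i j → i ≢ j → ¬ (∀ x → (V i x → V j x) × (V j x → V i x))
      sub        : ∀ i x → W i x → V i x
      shift      : ∀ i j a a′ b → W i a → W i a′ → W j b → V j ((a - a′) + b)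

  ⋃ : ∀ {p} {m : ℕ} → (Fin m → Pred Carrier p) → Pred Carrier p
  ⋃ W x = ∃ λ i → W i x

-- Fix a ∈ A and put t = a + c and b k = e k + c (for (2): t = c − a and b k = c − e k). Then
-- b k ∈ W (g k) and t − b k ∈ A − A, say t = b k + (w k − w′ k) with w k ∈ W (i k), w′ k ∈ W (j k).
-- The b k are as far apart as the e k, hence farther than any diameter, so the g k are distinct.
-- If i k = j k or j k = g k for some k, immersion puts t into ⋃ 𝒱 directly. Otherwise each k
-- points, through i k and j k, at no more than two l, so some pair k ≠ l is unlinked both ways;
-- subtracting the two expressions for t then gives a vanishing signed sum of six elements, at
-- most two from each member of 𝒲 and only positive ones from W (g k), which goodness forbids.
-- Any n-good qif with n ≥ 6 would do.

module Submission where

open import Defs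
open import Level using (Level; _⊔_)
open import Data.Nat as ℕ using (ℕ; zero; suc; z≤n; s≤s)
import Data.Nat.Properties as ℕP
open import Data.Integer as ℤ using (ℤ; 0ℤ; +≤+; +<+)
import Data.Integer.Properties as ℤP
open import Data.Sign.Properties using (s*s≡+)
open import Data.Fin using (Fin; zero; suc; _≟_; punchIn; combine; remQuot)
open import Data.Fin.Properties
  using ( any?; all?; injective⇒≤; ¬∀⟶∃¬; suc-injective; punchIn-injective; punchInᵢ≢i
        ; combine-injective; combine-remQuot)
import Data.Vec.Functional as Vector
open import Data.Product using (Σ; ∃; ∃₂; _×_; _,_; proj₁; proj₂; uncurry)
open import Data.Product.Properties using (,-injectiveˡ; ,-injectiveʳ; ×-≡,≡→≡)
open import Data.Sum using (_⊎_; inj₁; inj₂)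
open import Data.Empty using (⊥; ⊥-elim)
open import Data.List using (List; []; _∷_; length; _++_; map)
open import Data.List.Properties using (length-++; length-map)
open import Data.List.Relation.Unary.All as All using (All; []; _∷_)
open import Data.List.Relation.Unary.All.Properties using (map⁻)
open import Data.List.Relation.Unary.Any using (Any; here; there)
open import Data.List.Relation.Unary.AllPairs using (AllPairs; []; _∷_)
open import Function using (Injective; _∘_)
open import Relation.Unary using (Pred)
open import Relation.Nullary using (¬_; Dec; yes; no; contradiction)
open import Relation.Nullary.Decidable using (¬?; _×-dec_; _⊎-dec_)
open import Relation.Binary.PropositionalEquality
open import Relation.Binary.Structures using (IsTotalOrder)
open import Algebra.Bundles using (AbelianGroup)
import Algebra.Properties.AbelianGroup as AbelianGroupProperties
import Algebra.Properties.CommutativeSemigroup as CommutativeSemigroupProperties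

product-injective⇒≤ : ∀ {a b c d} (f : Fin a × Fin b → Fin c × Fin d) →
                      Injective _≡_ _≡_ f → a ℕ.* b ℕ.≤ c ℕ.* d
product-injective⇒≤ {a} {b} {c} {d} f f-inj = injective⇒≤ code-injective
  where
    code : Fin (a ℕ.* b) → Fin (c ℕ.* d)
    code x = uncurry combine (f (remQuot b x))

    code-injective : Injective _≡_ _≡_ code
    code-injective {x} {y} eq = begin
      x                                  ≡⟨ combine-remQuot {a} b x ⟨
      uncurry combine (remQuot {a} b x)  ≡⟨ cong (uncurry combine) (f-inj components≡) ⟩
      uncurry combine (remQuot {a} b y)  ≡⟨ combine-remQuot {a} b y ⟩
      y                                  ∎
      where
        open ≡-Reasoning
        fx = f (remQuot b x)
        fy = f (remQuot b y)
        components≡ : fx ≡ fy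
        components≡ = ×-≡,≡→≡ (combine-injective (proj₁ fx) (proj₂ fx) (proj₁ fy) (proj₂ fy) eq)

module _ {n m d : ℕ} (g : Fin (suc n) → Fin m) (g-injective : Injective _≡_ _≡_ g)
         (ptr : Fin (suc n) → Fin d → Fin m) where

  Points : Fin (suc n) → Fin (suc n) → Set
  Points k l = ∃ λ w → ptr k w ≡ g l

  private
    points? : ∀ k l → Dec (Points k l)
    points? k l = any? (λ w → ptr k w ≟ g l)

    Linked : Fin (suc n) → Fin n → Set
    Linked k j = Points k (punchIn k j) ⊎ Points (punchIn k j) k

    -- A linked pair is labelled by its endpoint that points at the other one and by the pointer
    -- used; as g is injective, the label determines the pair.
    label : ∀ {k j} → Linked k j → Fin (suc n) × Fin (d ℕ.* 2)
    label {k}     (inj₁ (w , _)) = k , combine w zero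
    label {k} {j} (inj₂ (w , _)) = punchIn k j , combine w (suc zero)

    label-injective : ∀ {k j k′ j′} (p : Linked k j) (p′ : Linked k′ j′) →
                      label p ≡ label p′ → (k , j) ≡ (k′ , j′)
    label-injective {k} {j} {k′} {j′} (inj₁ (w , p)) (inj₁ (w′ , p′)) eq
      with refl ← ,-injectiveˡ eq
      with refl ← proj₁ (combine-injective w zero w′ zero (,-injectiveʳ eq))
      = cong (k ,_) (punchIn-injective k j j′ (g-injective (trans (sym p) p′)))
    label-injective (inj₁ (w , _)) (inj₂ (w′ , _)) eq
      with () ← proj₂ (combine-injective w zero w′ (suc zero) (,-injectiveʳ eq))
    label-injective (inj₂ (w , _)) (inj₁ (w′ , _)) eq
      with () ← proj₂ (combine-injective w (suc zero) w′ zero (,-injectiveʳ eq))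
    label-injective {k} {j} {k′} {j′} (inj₂ (w , p)) (inj₂ (w′ , p′)) eq
      with refl ← proj₁ (combine-injective w (suc zero) w′ (suc zero) (,-injectiveʳ eq))
      with refl ← g-injective (trans (sym p) (trans (cong (λ v → ptr v w) (,-injectiveˡ eq)) p′))
      = cong (k ,_) (punchIn-injective k j j′ (,-injectiveˡ eq))

  unlinked-pair : d ℕ.* 2 ℕ.< n → ∃₂ λ k l → k ≢ l × ¬ Points k l × ¬ Points l k
  unlinked-pair d*2<n
    with any? (λ k → any? (λ j → ¬? (points? k (punchIn k j)) ×-dec ¬? (points? (punchIn k j) k)))
  ... | yes (k , j , ¬kj , ¬jk) = k , punchIn k j , (λ e → punchInᵢ≢i k j (sym e)) , ¬kj , ¬jk
  ... | no none = contradiction (ℕP.*-cancelˡ-≤ (suc n) (product-injective⇒≤ code code-injective))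
                                (ℕP.<⇒≱ d*2<n)
    where
      linked : ∀ k j → Linked k j
      linked k j with points? k (punchIn k j) | points? (punchIn k j) k
      ... | yes p  | _      = inj₁ p
      ... | no _   | yes p  = inj₂ p
      ... | no ¬kj | no ¬jk = ⊥-elim (none (k , j , ¬kj , ¬jk))

      code : Fin (suc n) × Fin n → Fin (suc n) × Fin (d ℕ.* 2)
      code (k , j) = label (linked k j)

      code-injective : Injective _≡_ _≡_ code
      code-injective {k , j} {k′ , j′} = label-injective (linked k j) (linked k′ j′)

Covers : ∀ {k m} → (Fin k → Fin m) → List (Fin m) → Set
Covers h xs = All (λ x → ∃ λ i → h i ≡ x) xs

outside-image : ∀ {k m} (h : Fin k → Fin m) → Injective _≡_ _≡_ h → k ℕ.< m → ∃ λ y → ∀ i → h i ≢ y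
outside-image {k} {m} h h-injective k<m with all? (λ y → any? (λ i → h i ≟ y))
... | yes onto = contradiction (injective⇒≤ section-injective) (ℕP.<⇒≱ k<m)
  where
    section : Fin m → Fin k
    section y = proj₁ (onto y)
    section-injective : Injective _≡_ _≡_ section
    section-injective {y} {y′} e = trans (sym (proj₂ (onto y))) (trans (cong h e) (proj₂ (onto y′)))
... | no ¬onto with ¬∀⟶∃¬ m _ (λ y → any? (λ i → h i ≟ y)) ¬onto
... | y , y∉ = y , λ i e → y∉ (i , e)

∷-injective : ∀ {k m} {y : Fin m} {h : Fin k → Fin m} → Injective _≡_ _≡_ h → (∀ i → h i ≢ y) →
              Injective _≡_ _≡_ (y Vector.∷ h)
∷-injective h-inj y∉ {zero}  {zero}  e = refl
∷-injective h-inj y∉ {zero}  {suc j} e = ⊥-elim (y∉ j (sym e))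
∷-injective h-inj y∉ {suc i} {zero}  e = ⊥-elim (y∉ i e)
∷-injective h-inj y∉ {suc i} {suc j} e = cong suc (h-inj e)

Covers-∷ : ∀ {k m} (y : Fin m) {h : Fin k → Fin m} {xs} → Covers h xs → Covers (y Vector.∷ h) xs
Covers-∷ y = All.map λ (i , e) → suc i , e

covering-injection : ∀ {m} k → k ℕ.≤ m → (xs : List (Fin m)) → length xs ℕ.≤ k →
                     Σ (Fin k → Fin m) λ h → Injective _≡_ _≡_ h × Covers h xs
covering-injection zero    _   []       _   = (λ ()) , (λ {}) , []
covering-injection (suc k) k<m []       _
  with h , h-inj , _ ← covering-injection k (ℕP.<⇒≤ k<m) [] z≤n
  with y , y∉ ← outside-image h h-inj k<m
  = y Vector.∷ h , ∷-injective h-inj y∉ , []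
covering-injection (suc k) k<m (x ∷ xs) (s≤s |xs|≤k)
  with h , h-inj , covered ← covering-injection k (ℕP.<⇒≤ k<m) xs |xs|≤k
  with any? (λ i → h i ≟ x)
... | no x∉ = x Vector.∷ h , ∷-injective h-inj (λ i e → x∉ (i , e)) , (zero , refl) ∷ Covers-∷ x covered
... | yes (i , hi≡x) with y , y∉ ← outside-image h h-inj k<m
  = y Vector.∷ h , ∷-injective h-inj y∉ , (suc i , hi≡x) ∷ Covers-∷ y covered

square-nonNeg : ∀ i → 0ℤ ℤ.≤ i ℤ.* i
square-nonNeg i rewrite s*s≡+ (ℤ.sign i) | ℤP.+◃n≡+n (ℤ.∣ i ∣ ℕ.* ℤ.∣ i ∣) = +≤+ z≤n

sumℤ-nonNeg : ∀ {n} (f : Fin n → ℤ) → (∀ i → 0ℤ ℤ.≤ f i) → 0ℤ ℤ.≤ sumℤ f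
sumℤ-nonNeg {zero}  f f≥0 = ℤP.≤-refl
sumℤ-nonNeg {suc n} f f≥0 = ℤP.+-mono-≤ (f≥0 zero) (sumℤ-nonNeg (λ i → f (suc i)) (λ i → f≥0 (suc i)))

sumℤ-pos : ∀ {n} (f : Fin n → ℤ) → (∀ i → 0ℤ ℤ.≤ f i) → ∀ i → 0ℤ ℤ.< f i → 0ℤ ℤ.< sumℤ f
sumℤ-pos {suc n} f f≥0 zero    fi>0 =
  ℤP.+-mono-<-≤ fi>0 (sumℤ-nonNeg (λ i → f (suc i)) (λ i → f≥0 (suc i)))
sumℤ-pos {suc n} f f≥0 (suc i) fi>0 =
  ℤP.+-mono-≤-< (f≥0 zero) (sumℤ-pos (λ i → f (suc i)) (λ i → f≥0 (suc i)) i fi>0)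

module AbGroupProperties {c : Level} (G : AbGroup c) where
  open AbGroup G

  abelianGroup : AbelianGroup c c
  abelianGroup = record { isAbelianGroup = isAbelianGroup }

  open AbelianGroup abelianGroup public
    using (assoc; comm; identityˡ; identityʳ; inverseʳ; commutativeSemigroup; commutativeMonoid)
  open AbelianGroupProperties abelianGroup public
    using (⁻¹-∙-comm; ⁻¹-involutive; \\-leftDividesʳ; //-rightDividesˡ)
  open CommutativeSemigroupProperties commutativeSemigroup public using (interchange; x∙yz≈xz∙y)

  sumH-cong : ∀ {n} {f f′ : Fin n → Carrier} → (∀ i → f i ≡ f′ i) → sumH G f ≡ sumH G f′
  sumH-cong {zero}  f≗f′ = refl
  sumH-cong {suc n} f≗f′ = cong₂ _+_ (f≗f′ zero) (sumH-cong (λ i → f≗f′ (suc i)))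

  sumH-+ : ∀ {n} (f f′ : Fin n → Carrier) → sumH G (λ i → f i + f′ i) ≡ sumH G f + sumH G f′
  sumH-+ {zero}  f f′ = sym (identityˡ 0#)
  sumH-+ {suc n} f f′ =
    trans (cong (f zero + f′ zero +_) (sumH-+ (λ i → f (suc i)) (λ i → f′ (suc i))))
          (interchange (f zero) (f′ zero) _ _)

  sumH-zero : ∀ {n} (f : Fin n → Carrier) → (∀ i → f i ≡ 0#) → sumH G f ≡ 0#
  sumH-zero {zero}  f f≗0 = refl
  sumH-zero {suc n} f f≗0 =
    trans (cong₂ _+_ (f≗0 zero) (sumH-zero (λ i → f (suc i)) (λ i → f≗0 (suc i)))) (identityˡ 0#)

  sumH-single : ∀ {n} (f : Fin n → Carrier) i → (∀ j → j ≢ i → f j ≡ 0#) → sumH G f ≡ f i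
  sumH-single {suc n} f zero    f≗0 =
    trans (cong (f zero +_) (sumH-zero (λ j → f (suc j)) (λ j → f≗0 (suc j) λ ()))) (identityʳ _)
  sumH-single {suc n} f (suc i) f≗0 =
    trans (cong₂ _+_ (f≗0 zero λ ())
                     (sumH-single (λ j → f (suc j)) i (λ j j≢i → f≗0 (suc j) (j≢i ∘ suc-injective))))
          (identityˡ _)

  -‿distrib-+- : ∀ x y z → - (x + (y - z)) ≡ - x + (- y + z)
  -‿distrib-+- x y z = begin
    - (x + (y - z))      ≡⟨ ⁻¹-∙-comm x (y - z) ⟨
    - x + - (y - z)      ≡⟨ cong (- x +_) (⁻¹-∙-comm y (- z)) ⟨
    - x + (- y + - - z)  ≡⟨ cong (λ u → - x + (- y + u)) (⁻¹-involutive z) ⟩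
    - x + (- y + z)      ∎
    where open ≡-Reasoning

  [x+y]+[z-x]≡z+y : ∀ x y z → (x + y) + (z - x) ≡ z + y
  [x+y]+[z-x]≡z+y x y z = begin
    (x + y) + (z - x)   ≡⟨ comm (x + y) (z - x) ⟩
    (z - x) + (x + y)   ≡⟨ assoc (z - x) x y ⟨
    ((z - x) + x) + y   ≡⟨ cong (_+ y) (//-rightDividesˡ x z) ⟩
    z + y               ∎
    where open ≡-Reasoning

  [x-y]+[y-z]≡x-z : ∀ x y z → (x - y) + (y - z) ≡ x - z
  [x-y]+[y-z]≡x-z x y z = begin
    (x - y) + (y - z)   ≡⟨ assoc (x - y) y (- z) ⟨
    ((x - y) + y) - z   ≡⟨ cong (_- z) (//-rightDividesˡ y x) ⟩
    x - z               ∎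
    where open ≡-Reasoning

module SignedSums {c p : Level} (G : AbGroup c) {m : ℕ} (W : Fin m → Pred (AbGroup.Carrier G) p) where
  open AbGroup G
  open AbGroupProperties G

  record Term : Set (c ⊔ p) where
    constructor term
    field
      idx : Fin m
      sgn : Sgn
      val : Carrier
      mem : W idx val
  open Term public

  signedSum : List Term → Carrier
  signedSum []      = 0#
  signedSum (t ∷ L) = _·_ G (sgn t) (val t) + signedSum L

  signedSum-++ : ∀ L L′ → signedSum (L ++ L′) ≡ signedSum L + signedSum L′
  signedSum-++ []      L′ = sym (identityˡ _)
  signedSum-++ (t ∷ L) L′ = trans (cong (_ +_) (signedSum-++ L L′)) (sym (assoc _ _ _))

  Entry : Fin m → Set (c ⊔ p)
  Entry x = Sgn × Σ Carrier (W x)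

  entrySum : ∀ {x} → List (Entry x) → Carrier
  entrySum []                  = 0#
  entrySum ((ι , b , _) ∷ es) = _·_ G ι b + entrySum es

  termsAt : (x : Fin m) → List Term → List (Entry x)
  termsAt x []      = []
  termsAt x (t ∷ L) with idx t ≟ x
  ... | yes refl = (sgn t , val t , mem t) ∷ termsAt x L
  ... | no _     = termsAt x L

  contribution : Term → Fin m → Carrier
  contribution t x with idx t ≟ x
  ... | yes _ = _·_ G (sgn t) (val t)
  ... | no _  = 0#

  entrySum-termsAt-∷ : ∀ x t L → entrySum (termsAt x (t ∷ L)) ≡ contribution t x + entrySum (termsAt x L)
  entrySum-termsAt-∷ x t L with idx t ≟ x
  ... | yes refl = refl
  ... | no _     = sym (identityˡ _)

  signedSum-regroup : ∀ {n} (h : Fin n → Fin m) → Injective _≡_ _≡_ h → (L : List Term) →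
                      Covers h (map idx L) → signedSum L ≡ sumH G (λ i → entrySum (termsAt (h i) L))
  signedSum-regroup {n} h h-inj []      []                   = sym (sumH-zero {n} _ (λ _ → refl))
  signedSum-regroup {n} h h-inj (t ∷ L) ((i , hi≡t) ∷ covered) = sym (begin
    sumH G (λ j → entrySum (termsAt (h j) (t ∷ L)))
      ≡⟨ sumH-cong (λ j → entrySum-termsAt-∷ (h j) t L) ⟩
    sumH G (λ j → contribution t (h j) + entrySum (termsAt (h j) L))
      ≡⟨ sumH-+ {n} _ _ ⟩
    sumH G (λ j → contribution t (h j)) + sumH G (λ j → entrySum (termsAt (h j) L))
      ≡⟨ cong₂ _+_ (trans (sumH-single _ i elsewhere) at-i) (sym (signedSum-regroup h h-inj L covered)) ⟩
    _·_ G (sgn t) (val t) + signedSum L ∎)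
    where
      open ≡-Reasoning
      elsewhere : ∀ j → j ≢ i → contribution t (h j) ≡ 0#
      elsewhere j j≢i with idx t ≟ h j
      ... | yes t≡hj = ⊥-elim (j≢i (h-inj (trans (sym t≡hj) (sym hi≡t))))
      ... | no _     = refl
      at-i : contribution t (h i) ≡ _·_ G (sgn t) (val t)
      at-i with idx t ≟ h i
      ... | yes _   = refl
      ... | no t≢hi = ⊥-elim (t≢hi (sym hi≡t))

  Distinct : List Term → Set (c ⊔ p)
  Distinct = AllPairs (λ t t′ → idx t ≢ idx t′)

  termsAt-++ : ∀ x L L′ → termsAt x (L ++ L′) ≡ termsAt x L ++ termsAt x L′
  termsAt-++ x []      L′ = refl
  termsAt-++ x (t ∷ L) L′ with idx t ≟ x
  ... | yes refl = cong (_ ∷_) (termsAt-++ x L L′)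
  ... | no _     = termsAt-++ x L L′

  termsAt-absent : ∀ x L → All (λ t → idx t ≢ x) L → termsAt x L ≡ []
  termsAt-absent x []      []            = refl
  termsAt-absent x (t ∷ L) (t≢x ∷ L≢x) with idx t ≟ x
  ... | yes t≡x = ⊥-elim (t≢x t≡x)
  ... | no _    = termsAt-absent x L L≢x

  length-termsAt-distinct : ∀ x L → Distinct L → length (termsAt x L) ℕ.≤ 1
  length-termsAt-distinct x []      []               = z≤n
  length-termsAt-distinct x (t ∷ L) (t≢L ∷ distinct) with idx t ≟ x
  ... | yes refl = s≤s (ℕP.≤-reflexive (cong length (termsAt-absent x L (All.map (λ t≢t′ → t≢t′ ∘ sym) t≢L))))
  ... | no _     = length-termsAt-distinct x L distinct

  length-termsAt-++-distinct : ∀ L L′ → Distinct L → Distinct L′ → ∀ x → length (termsAt x (L ++ L′)) ℕ.≤ 2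
  length-termsAt-++-distinct L L′ dL dL′ x rewrite termsAt-++ x L L′ | length-++ (termsAt x L) {termsAt x L′} =
    ℕP.+-mono-≤ (length-termsAt-distinct x L dL) (length-termsAt-distinct x L′ dL′)

  Positive : ∀ {x} → Entry x → Set
  Positive (ι , _) = ι ≡ pos

  termsAt-positive : ∀ x L → All (λ t → idx t ≡ x → sgn t ≡ pos) L → All Positive (termsAt x L)
  termsAt-positive x []      []          = []
  termsAt-positive x (t ∷ L) (pt ∷ pL) with idx t ≟ x
  ... | yes refl = pt refl ∷ termsAt-positive x L pL
  ... | no _     = termsAt-positive x L pL

  termsAt-nonempty : ∀ x L → Any (λ t → idx t ≡ x) L → 0 ℕ.< length (termsAt x L)
  termsAt-nonempty x (t ∷ L) present with idx t ≟ x
  termsAt-nonempty x (t ∷ L) present       | yes refl = s≤s z≤n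
  termsAt-nonempty x (t ∷ L) (here t≡x)    | no t≢x   = ⊥-elim (t≢x t≡x)
  termsAt-nonempty x (t ∷ L) (there present) | no _   = termsAt-nonempty x L present

  Pair : Fin m → Set (c ⊔ p)
  Pair x = Entry x × Entry x

  pairValue : ∀ {x} → Pair x → Carrier
  pairValue ((ι , b , _) , (ι′ , b′ , _)) = _·_ G ι b + _·_ G ι′ b′

  pairWeight : ∀ {x} → Pair x → ℤ
  pairWeight ((ι , _) , (ι′ , _)) = (toℤ ι ℤ.+ toℤ ι′) ℤ.* (toℤ ι ℤ.+ toℤ ι′)

  pairWeight-nonNeg : ∀ {x} (P : Pair x) → 0ℤ ℤ.≤ pairWeight P
  pairWeight-nonNeg ((ι , _) , (ι′ , _)) = square-nonNeg (toℤ ι ℤ.+ toℤ ι′)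

  toPair : ∀ {x} → Σ Carrier (W x) → List (Entry x) → Pair x
  toPair d []           = (zer , d) , (zer , d)
  toPair d (e ∷ [])     = e , (zer , d)
  toPair d (e ∷ e′ ∷ _) = e , e′

  toPair-value : ∀ {x} d (es : List (Entry x)) → length es ℕ.≤ 2 → pairValue (toPair d es) ≡ entrySum es
  toPair-value d []                    _                   = identityˡ 0#
  toPair-value d (e ∷ [])              _                   = refl
  toPair-value d ((ι , b , _) ∷ e′ ∷ []) _                 = cong (_·_ G ι b +_) (sym (identityʳ _))
  toPair-value d (e ∷ e′ ∷ e″ ∷ es)    (s≤s (s≤s ()))

  toPair-weight-pos : ∀ {x} d (es : List (Entry x)) → All Positive es → 0 ℕ.< length es →
                      0ℤ ℤ.< pairWeight (toPair d es)
  toPair-weight-pos d (_ ∷ [])     (refl ∷ [])       _ = +<+ (s≤s z≤n)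
  toPair-weight-pos d (_ ∷ _ ∷ _)  (refl ∷ refl ∷ _) _ = +<+ (s≤s z≤n)

  module _ {n : ℕ} (good : IsGoodQif G n m W) where
    open IsGoodQif good

    pairSum≢0 : (h : Fin n → Fin m) → Injective _≡_ _≡_ h → (P : ∀ i → Pair (h i)) →
                ∀ i₀ → 0ℤ ℤ.< pairWeight (P i₀) → sumH G (λ i → pairValue (P i)) ≢ 0#
    pairSum≢0 h h-inj P i₀ weight>0 =
      qif h (λ _ _ → h-inj) (λ i → proj₁ (proj₂ (proj₁ (P i)))) (λ i → proj₁ (proj₂ (proj₂ (P i))))
          (λ i → proj₂ (proj₂ (proj₁ (P i)))) (λ i → proj₂ (proj₂ (proj₂ (P i))))
          (λ i → proj₁ (proj₁ (P i))) (λ i → proj₁ (proj₂ (P i)))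
          (λ Σweight≡0 → ℤP.<⇒≢ (sumℤ-pos _ (λ i → pairWeight-nonNeg (P i)) i₀ weight>0) (sym Σweight≡0))

    signedSum≢0 : (L : List Term) → length L ℕ.≤ n → (∀ x → length (termsAt x L) ℕ.≤ 2) →
                  ∀ x → Any (λ t → idx t ≡ x) L → All (λ t → idx t ≡ x → sgn t ≡ pos) L →
                  signedSum L ≢ 0#
    signedSum≢0 L |L|≤n twice x present positive
      with h , h-inj , covered ←
             covering-injection n size (map idx L) (subst (ℕ._≤ n) (sym (length-map idx L)) |L|≤n)
      with (i₀ , hi₀≡t) , t≡x ← All.lookupAny (map⁻ covered) present
      with refl ← trans hi₀≡t t≡x
      = λ sum≡0 → pairSum≢0 h h-inj P i₀ weight>0 (trans pairSum≡signedSum sum≡0)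
      where
        open ≡-Reasoning
        P : ∀ i → Pair (h i)
        P i = toPair (nonempty (h i)) (termsAt (h i) L)

        weight>0 : 0ℤ ℤ.< pairWeight (P i₀)
        weight>0 = toPair-weight-pos _ _ (termsAt-positive (h i₀) L positive)
                                         (termsAt-nonempty (h i₀) L present)

        pairSum≡signedSum : sumH G (λ i → pairValue (P i)) ≡ signedSum L
        pairSum≡signedSum = begin
          sumH G (λ i → pairValue (P i))
            ≡⟨ sumH-cong (λ i → toPair-value (nonempty (h i)) (termsAt (h i) L) (twice (h i))) ⟩
          sumH G (λ i → entrySum (termsAt (h i) L))
            ≡⟨ signedSum-regroup h h-inj L covered ⟨
          signedSum L ∎

module SumsetWitnesses {c p : Level} (G : AbGroup c) {m : ℕ} {W V : Fin m → Pred (AbGroup.Carrier G) p}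
                       (immersed : IsImmersed G W V) where
  open AbGroup G
  open AbGroupProperties G
  open SignedSums G W
  open IsImmersed immersed

  record SumsetWitness (t : Carrier) : Set (c ⊔ p) where
    field
      g i j  : Fin m
      b w w′ : Carrier
      b∈     : W g b
      w∈     : W i w
      w′∈    : W j w′
      t≡     : t ≡ b + (w - w′)
  open SumsetWitness

  partners : ∀ {t} → SumsetWitness t → Fin 2 → Fin m
  partners s zero    = i s
  partners s (suc _) = j s

  degenerate⇒⋃V : ∀ {t} (s : SumsetWitness t) → i s ≡ j s ⊎ j s ≡ g s → ⋃ G V t
  degenerate⇒⋃V s (inj₁ i≡j) =
    g s , subst (V (g s)) (sym (trans (t≡ s) (comm _ _)))
                (shift (i s) (g s) (w s) (w′ s) (b s)
                       (w∈ s) (subst (λ y → W y (w′ s)) (sym i≡j) (w′∈ s)) (b∈ s))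
  degenerate⇒⋃V s (inj₂ j≡g) =
    i s , subst (V (i s)) (sym (trans (t≡ s) (x∙yz≈xz∙y (b s) (w s) (- w′ s))))
                (shift (g s) (i s) (b s) (w′ s) (w s) (b∈ s) (subst (λ y → W y (w′ s)) j≡g (w′∈ s)) (w∈ s))

  separated⇒⊥ : ∀ {n t} → IsGoodQif G n m W → 6 ℕ.≤ n → (s s′ : SumsetWitness t) →
                i s ≢ j s → j s ≢ g s → i s′ ≢ j s′ → g s ≢ g s′ →
                (∀ k → partners s k ≢ g s′) → (∀ k → partners s′ k ≢ g s) → ⊥
  separated⇒⊥ {t = t} good 6≤n s s′ i≢j j≢g i′≢j′ g≢g′ s↛s′ s′↛s =
    signedSum≢0 good (A ++ B) 6≤n (length-termsAt-++-distinct A B A-distinct B-distinct) (g s)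
      (there (there (there (here refl)))) positive sum≡0
    where
      -- Each half meets three distinct members, so no member carries more than two terms.
      A B : List Term
      A = term (i s) pos (w s) (w∈ s) ∷ term (j s) neg (w′ s) (w′∈ s) ∷ term (g s′) neg (b s′) (b∈ s′) ∷ []
      B = term (g s) pos (b s) (b∈ s) ∷ term (i s′) neg (w s′) (w∈ s′) ∷ term (j s′) pos (w′ s′) (w′∈ s′) ∷ []

      A-distinct : Distinct A
      A-distinct = (i≢j ∷ s↛s′ zero ∷ []) ∷ (s↛s′ (suc zero) ∷ []) ∷ [] ∷ []

      B-distinct : Distinct B
      B-distinct = ((s′↛s zero ∘ sym) ∷ (s′↛s (suc zero) ∘ sym) ∷ []) ∷ (i′≢j′ ∷ []) ∷ [] ∷ []

      positive : All (λ u → idx u ≡ g s → sgn u ≡ pos) (A ++ B)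
      positive = (λ _ → refl) ∷ (⊥-elim ∘ j≢g) ∷ (⊥-elim ∘ g≢g′ ∘ sym)
               ∷ (λ _ → refl) ∷ (⊥-elim ∘ s′↛s zero) ∷ (λ _ → refl) ∷ []

      reorder : ∀ x y z u v q → (x + (y + (z + 0#))) + (u + (v + (q + 0#))) ≡ (u + (x + y)) + (z + (v + q))
      reorder = solve 6 (λ x y z u v q → (x ⊕ (y ⊕ (z ⊕ id))) ⊕ (u ⊕ (v ⊕ (q ⊕ id)))
                                       ⊜ (u ⊕ (x ⊕ y)) ⊕ (z ⊕ (v ⊕ q))) refl
        where open import Algebra.Solver.CommutativeMonoid commutativeMonoid

      sum≡0 : signedSum (A ++ B) ≡ 0#
      sum≡0 = begin
        signedSum (A ++ B)                                   ≡⟨ signedSum-++ A B ⟩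
        signedSum A + signedSum B                            ≡⟨ reorder _ _ _ _ _ _ ⟩
        (b s + (w s - w′ s)) + (- b s′ + (- w s′ + w′ s′))
          ≡⟨ cong₂ _+_ (t≡ s) (-‿distrib-+- (b s′) (w s′) (w′ s′)) ⟨
        t + - (b s′ + (w s′ - w′ s′))                        ≡⟨ cong (λ u → t - u) (t≡ s′) ⟨
        t - t                                                ≡⟨ inverseʳ t ⟩
        0#                                                   ∎
        where open ≡-Reasoning

  witnesses⇒⋃V : ∀ {n t} → IsGoodQif G (suc n) m W → 4 ℕ.< n →
                 (s : Fin (suc n) → SumsetWitness t) → Injective _≡_ _≡_ (g ∘ s) → ⋃ G V t
  witnesses⇒⋃V good 4<n s g-inj with any? (λ k → (i (s k) ≟ j (s k)) ⊎-dec (j (s k) ≟ g (s k)))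
  ... | yes (k , degenerate) = degenerate⇒⋃V (s k) degenerate
  ... | no nondegenerate
    with k , l , k≢l , k↛l , l↛k ← unlinked-pair (g ∘ s) g-inj (partners ∘ s) 4<n
    = ⊥-elim (separated⇒⊥ good (s≤s 4<n) (s k) (s l)
        (λ e → nondegenerate (k , inj₁ e)) (λ e → nondegenerate (k , inj₂ e)) (λ e → nondegenerate (l , inj₁ e))
        (k≢l ∘ g-inj) (λ w e → k↛l (w , e)) (λ w e → l↛k (w , e)))

module _ {c r ℓ : Level} (G : AbGroup c) (R : OrderedAbGroup r ℓ) where
  open AbGroup G
  private module R = OrderedAbGroup R

  ¬DiamLT-distance : ∀ {p} (ρ : Carrier → Carrier → R.Carrier) {X : Pred Carrier p} {x y} →
                     X x → X y → ¬ DiamLT G R ρ X (ρ x y)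
  ¬DiamLT-distance ρ x∈X y∈X (s , (s≤ρxy , s≢ρxy) , bounded) =
    s≢ρxy (IsTotalOrder.antisym R.isTotalOrder s≤ρxy (bounded _ _ x∈X y∈X))

  reflection-isometry : (ρ : Carrier → Carrier → R.Carrier) → IsMetric G R ρ → TranslationInvariant G R ρ →
                        ∀ z x y → ρ (z - x) (z - y) ≡ ρ x y
  reflection-isometry ρ metric invariant z x y = begin
    ρ (z - x) (z - y)                    ≡⟨ cong₂ ρ (comm z (- x)) (comm z (- y)) ⟩
    ρ (- x + z) (- y + z)                ≡⟨ invariant (- x) (- y) z ⟩
    ρ (- x) (- y)                        ≡⟨ invariant (- x) (- y) (x + y) ⟨
    ρ (- x + (x + y)) (- y + (x + y))
      ≡⟨ cong₂ ρ (\\-leftDividesʳ x y) (trans (cong (- y +_) (comm x y)) (\\-leftDividesʳ y x)) ⟩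
    ρ y x                                ≡⟨ IsMetric.sym metric y x ⟩
    ρ x y                                ∎
    where
      open ≡-Reasoning
      open AbGroupProperties G

module _ {c r ℓ p : Level} (G : AbGroup c) (R : OrderedAbGroup r ℓ)
         (ρ : AbGroup.Carrier G → AbGroup.Carrier G → OrderedAbGroup.Carrier R)
         {n m : ℕ} {W V : Fin m → Pred (AbGroup.Carrier G) p}
         (good : IsGoodQif G (suc n) m W) (immersed : IsImmersed G W V) (4<n : 4 ℕ.< n)
         (A : Pred (AbGroup.Carrier G) p)
         (A-A⊆W-W : ∀ a a′ → A a → A a′ → ∃ λ i → ∃ λ j → ∃ λ w → ∃ λ w′ →
                    W i w × W j w′ × (AbGroup._-_ G a a′ ≡ AbGroup._-_ G w w′))
         (separated : ∀ a a′ → A a → A a′ → a ≢ a′ → ∀ i → DiamLT G R ρ (W i) (ρ a a′)) where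
  open AbGroup G
  open SumsetWitnesses G immersed

  ⋃V-near-isometric-copy :
    (e b : Fin (suc n) → Carrier) → Injective _≡_ _≡_ e → (∀ k → A (e k)) → (∀ k → ⋃ G W (b k)) →
    (∀ k l → ρ (b k) (b l) ≡ ρ (e k) (e l)) →
    ∀ t → (∀ k → ∃₂ λ a a′ → A a × A a′ × t ≡ b k + (a - a′)) → ⋃ G V t
  ⋃V-near-isometric-copy e b e-inj e∈A b∈⋃W isometric t near = witnesses⇒⋃V good 4<n witness g-injective
    where
      witness : Fin (suc n) → SumsetWitness t
      witness k with a , a′ , a∈A , a′∈A , t≡ ← near k
                with i , j , w , w′ , w∈ , w′∈ , a-a′≡ ← A-A⊆W-W a a′ a∈A a′∈A
        = record { g = proj₁ (b∈⋃W k) ; i = i ; j = j ; b = b k ; w = w ; w′ = w′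
                 ; b∈ = proj₂ (b∈⋃W k) ; w∈ = w∈ ; w′∈ = w′∈ ; t≡ = trans t≡ (cong (b k +_) a-a′≡) }

      g-injective : Injective _≡_ _≡_ (SumsetWitness.g ∘ witness)
      g-injective {k} {l} gk≡gl with k ≟ l
      ... | yes k≡l = k≡l
      ... | no k≢l  = ⊥-elim (¬DiamLT-distance G R ρ (proj₂ (b∈⋃W k))
                               (subst (λ x → W x (b l)) (sym gk≡gl) (proj₂ (b∈⋃W l)))
                               (subst (DiamLT G R ρ (W _)) (sym (isometric k l))
                                      (separated (e k) (e l) (e∈A k) (e∈A l) (k≢l ∘ e-inj) _)))

lemma3p4 : {c r ℓ p : Level} (G : AbGroup c) (R : OrderedAbGroup r ℓ) →
    let open AbGroup G in
    (ρ : Carrier → Carrier → OrderedAbGroup.Carrier R) →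
    IsMetric G R ρ → TranslationInvariant G R ρ →
    (m : ℕ) (W V : Fin m → Pred Carrier p) →
    IsGoodQif G 8 m W →
    IsImmersed G W V →
    (A A′ : Pred Carrier p) →
    (∀ x → A′ x → A x) →
    (e : Fin 8 → Carrier) → (∀ i j → e i ≡ e j → i ≡ j) →
    (∀ x → A′ x → ∃ λ i → e i ≡ x) → (∀ i → A′ (e i)) →
    (∀ a b → A a → A b → ∃ λ i → ∃ λ j → ∃ λ w → ∃ λ w′ →
      W i w × W j w′ × (a - b ≡ w - w′)) →
    (∀ a b → A a → A b → a ≢ b → ∀ i → DiamLT G R ρ (W i) (ρ a b)) →
    ((c′ : Carrier) → (∀ a → A′ a → ⋃ G W (a + c′)) → ∀ a → A a → ⋃ G V (a + c′))
    ×
    ((c′ : Carrier) → (∀ a → A′ a → ⋃ G W (c′ - a)) → ∀ a → A a → ⋃ G V (c′ - a))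
lemma3p4 G R ρ metric invariant m W V good immersed A A′ A′⊆A e e-inj _ e∈A′ A-A⊆W-W separated =
  translate , reflect
  where
    open AbGroup G
    open AbGroupProperties G

    near-copy : (b : Fin 8 → Carrier) → (∀ k → ⋃ G W (b k)) → (∀ k l → ρ (b k) (b l) ≡ ρ (e k) (e l)) →
                ∀ t → (∀ k → ∃₂ λ a a′ → A a × A a′ × t ≡ b k + (a - a′)) → ⋃ G V t
    near-copy b = ⋃V-near-isometric-copy G R ρ good immersed (s≤s (s≤s (s≤s (s≤s (s≤s z≤n)))))
                    A A-A⊆W-W separated e b (e-inj _ _) (λ k → A′⊆A _ (e∈A′ k))

    translate : (c′ : Carrier) → (∀ a → A′ a → ⋃ G W (a + c′)) → ∀ a → A a → ⋃ G V (a + c′)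
    translate c′ covered a a∈A =
      near-copy (λ k → e k + c′) (λ k → covered _ (e∈A′ k)) (λ k l → invariant (e k) (e l) c′) (a + c′)
        (λ k → a , e k , a∈A , A′⊆A _ (e∈A′ k) , sym ([x+y]+[z-x]≡z+y (e k) c′ a))

    reflect : (c′ : Carrier) → (∀ a → A′ a → ⋃ G W (c′ - a)) → ∀ a → A a → ⋃ G V (c′ - a)
    reflect c′ covered a a∈A =
      near-copy (λ k → c′ - e k) (λ k → covered _ (e∈A′ k))
        (λ k l → reflection-isometry G R ρ metric invariant c′ (e k) (e l)) (c′ - a)
        (λ k → e k , a , A′⊆A _ (e∈A′ k) , a∈A , sym ([x-y]+[y-z]≡x-z c′ (e k) a))
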